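{- Let $p,q\geq 3$ be distinct primes, $\alpha,\beta\geq 1$ integers, and $\Gamma=\mathrm{Cay}(\mathbb{Z}_{p}\times\mathbb{Z}_{p^{\alpha}q^{\beta}},\Phi)$ with $\Phi=\varphi_p\times\varphi_{p^{\alpha}q^{\beta}}$. If one of $p,q$ equals $3$, then $\gamma_t(\Gamma)=\gamma_c(\Gamma)=5$; if $p,q\geq 5$, then $\gamma_t(\Gamma)=\gamma_c(\Gamma)=4$.
   Context: For $n\geq 1$, $\mathbb{Z}_n=\{0,\dots,n-1\}$ is the integers mod $n$ and $\varphi_n$ is the set of elements of $\mathbb{Z}_n$ coprime to $n$ ($\varphi_p=\mathbb{Z}_p\setminus\{0\}$). $\mathrm{Cay}(\mathbb{Z}_p\times\mathbb{Z}_m,\varphi_p\times\varphi_m)$ is the graph on $\mathbb{Z}_p\times\mathbb{Z}_m$ where $(u,v)\sim(u',v')$ iff $u-u'\in\varphi_p$ and $v-v'\in\varphi_m$. A total dominating set is a vertex set $T$ such that every vertex is adjacent to some vertex of $T$; $\gamma_t$ is the minimum size of one. A connected dominating set is a dominating set inducing a connected subgraph; $\gamma_c$ is the minimum size of one. -}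

module Defs where

open import Data.Nat using (ℕ; zero; suc; _+_; _∸_; _≤_; _%_)
open import Data.Nat.Coprimality using (Coprime)
open import Data.Fin using (Fin; toℕ)
open import Data.Product using (_×_; ∃; _,_)
open import Data.List using (List; length)
open import Data.List.Membership.Propositional using (_∈_)
open import Data.List.Relation.Unary.Unique.Propositional using (Unique)
open import Data.Sum using (_⊎_)
open import Relation.Binary.PropositionalEquality using (_≡_)

diffMod : {n : ℕ} → Fin n → Fin n → ℕ
diffMod {suc k} u v = (toℕ u + suc k ∸ toℕ v) % suc k

-- a ∈ φ_n  (a ∈ ℤ_n coprime to n), applied to a = u - v
InPhi : {n : ℕ} → Fin n → Fin n → Set
InPhi {n} u v = Coprime (diffMod u v) n

Vertex : ℕ → ℕ → Set
Vertex a b = Fin a × Fin b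

Adj : {a b : ℕ} → Vertex a b → Vertex a b → Set
Adj (u , v) (u' , v') = InPhi u u' × InPhi v v'

-- T (a finite vertex set, given as a duplicate-free list) is total dominating
IsTotalDominating : {a b : ℕ} → List (Vertex a b) → Set
IsTotalDominating {a} {b} T = (x : Vertex a b) → ∃ λ t → t ∈ T × Adj x t

IsDominating : {a b : ℕ} → List (Vertex a b) → Set
IsDominating {a} {b} T = (x : Vertex a b) → x ∈ T ⊎ (∃ λ t → t ∈ T × Adj x t)

data ReachIn {a b : ℕ} (T : List (Vertex a b)) : Vertex a b → Vertex a b → Set where
  here : ∀ {x} → ReachIn T x x
  step : ∀ {x y z} → Adj x y → y ∈ T → ReachIn T y z → ReachIn T x z

InducesConnected : {a b : ℕ} → List (Vertex a b) → Set
InducesConnected T = ∀ {x y} → x ∈ T → y ∈ T → ReachIn T x y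

IsConnectedDominating : {a b : ℕ} → List (Vertex a b) → Set
IsConnectedDominating T = IsDominating T × InducesConnected T

IsMinSize : {a b : ℕ} → (List (Vertex a b) → Set) → ℕ → Set
IsMinSize {a} {b} P k =
  (∃ λ (T : List (Vertex a b)) → Unique T × length T ≡ k × P T)
  × ((T : List (Vertex a b)) → Unique T → P T → k ≤ length T)

γt≡ : ℕ → ℕ → ℕ → Set
γt≡ a b k = IsMinSize {a} {b} IsTotalDominating k

γc≡ : ℕ → ℕ → ℕ → Set
γc≡ a b k = IsMinSize {a} {b} IsConnectedDominating k

module Submission where

-- Adjacency of (u , v) and (u′ , v′) only depends on the three coordinates u mod p, v mod p and
-- v mod q: the vertices are adjacent iff they differ in all three, and by the Chinese remainder
-- theorem every triple of coordinates occurs.  So a vertex set T fails to be total dominating as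
-- soon as it is covered by three "lines", one for each coordinate: the vertex whose k-th
-- coordinate is that of the k-th line is adjacent to nothing in T.  Any three vertices are
-- covered, and so are any four when one coordinate takes only three values (p = 3 or q = 3),
-- because two of them then share that coordinate.  Conversely the diagonal {(i , i , i) | i < 4}
-- totally dominates when p , q ≥ 5, and for p = 3 or q = 3 explicit five-vertex sets do.  Each of
-- these sets has a vertex adjacent to all the others, hence is connected; since a connected
-- dominating set with at least two vertices is total dominating, γ_c = γ_t.

open import Defs
open import Data.Nat
  using (ℕ; zero; suc; _+_; _*_; _∸_; _^_; _⊓_; _≤_; _<_; _%_; _/_; NonZero; z≤n; s≤s; s≤s⁻¹;
         nonTrivial⇒≢1; nonTrivial⇒n>1; >-nonZero⁻¹)
open import Data.Nat.Properties
open import Data.Nat.DivMod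
  using (_mod_; m≡m%n+[m/n]*n; [m+kn]%n≡m%n; %-remove-+ˡ; %-remove-+ʳ; m%n<n; m<n⇒m%n≡m; m∣n⇒o%n%m≡o%m)
open import Data.Nat.Divisibility
  using (_∣_; divides; ∣-refl; ∣-trans; ∣1⇒≡1; m∣m*n; n∣m*n; ∣⇒≤; ∣n∣m%n⇒∣m; %-presˡ-∣)
open import Data.Nat.Coprimality using (Coprime; coprime-divisor; coprime-Bézout)
open import Data.Nat.GCD using (module Bézout)
open import Data.Nat.Primality
  using (Prime; prime⇒irreducible; prime⇒nonTrivial; prime⇒nonZero; composite⇒¬prime; composite[4])
open import Data.Nat.Tactic.RingSolver using (solve-∀)
open import Data.Fin using (Fin; toℕ; fromℕ<)
open import Data.Fin.Properties using (toℕ<n; toℕ-fromℕ<) renaming (_≟_ to _≟ᶠ_)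
open import Data.List using (List; []; _∷_; length; filter; upTo; applyUpTo)
open import Data.List.Properties using (filter-all; filter-accept; filter-reject; length-upTo; length-applyUpTo)
open import Data.List.Relation.Unary.All as All using (All; []; _∷_)
open import Data.List.Relation.Unary.Any using (here; there)
open import Data.List.Relation.Unary.Unique.Propositional using (Unique; []; _∷_)
import Data.List.Relation.Unary.Unique.Propositional.Properties as Unique
open import Data.List.Membership.Propositional using (_∈_)
open import Data.List.Membership.Propositional.Properties
  using (∈-filter⁻; ∈-upTo⁺; ∈-upTo⁻; ∈-applyUpTo⁺; ∈-applyUpTo⁻)
open import Data.Product using (_×_; _,_; ∃; proj₁; proj₂)
open import Data.Product.Properties using (≡-dec)
open import Data.Sum using (_⊎_; inj₁; inj₂; [_,_])
open import Data.Empty using (⊥-elim)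
open import Function using (_∘_; _⇔_; mk⇔; Equivalence)
open import Relation.Nullary using (¬_; yes; no; ¬?; _×-dec_)
open import Relation.Unary using (Decidable)
open import Relation.Binary.Definitions using (DecidableEquality)
open import Relation.Binary.PropositionalEquality
  using (_≡_; _≢_; refl; sym; trans; cong; cong₂; subst; ≢-sym; module ≡-Reasoning)

≢? : ∀ y → Decidable (_≢ y)
≢? y x = ¬? (x ≟ y)

length-filter-≢? : ∀ y {xs} → Unique xs → length xs ≤ suc (length (filter (≢? y) xs))
length-filter-≢? y {[]}     []                   = z≤n
length-filter-≢? y {x ∷ xs} (x≢xs ∷ xs-unique) with x ≟ y
... | yes refl = begin
  suc (length xs)                        ≡⟨ cong (suc ∘ length) (filter-all (≢? x) (All.map ≢-sym x≢xs)) ⟨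
  suc (length (filter (≢? x) xs))        ≡⟨ cong (suc ∘ length) (filter-reject (≢? x) (λ x≢x → x≢x refl)) ⟨
  suc (length (filter (≢? x) (x ∷ xs)))  ∎
  where open ≤-Reasoning
... | no x≢y = begin
  suc (length xs)                        ≤⟨ s≤s (length-filter-≢? y xs-unique) ⟩
  suc (suc (length (filter (≢? y) xs)))  ≡⟨ cong (suc ∘ length) (filter-accept (≢? y) x≢y) ⟨
  suc (length (filter (≢? y) (x ∷ xs)))  ∎
  where open ≤-Reasoning

longer⇒∃-avoiding : ∀ ys {xs} → Unique xs → length ys < length xs → ∃ λ x → x ∈ xs × All (_≢ x) ys
longer⇒∃-avoiding []       {x ∷ _} _ _ = x , here refl , []
longer⇒∃-avoiding (y ∷ ys) xs-unique |y∷ys|<|xs|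
  with x , x∈ , ys≢x ← longer⇒∃-avoiding ys (Unique.filter⁺ (≢? y) xs-unique)
                         (s≤s⁻¹ (≤-trans |y∷ys|<|xs| (length-filter-≢? y xs-unique)))
  with x∈xs , x≢y ← ∈-filter⁻ (≢? y) x∈
  = x , x∈xs , ≢-sym x≢y ∷ ys≢x

pigeonhole : ∀ {m xs} → All (_< m) xs → m < length xs → ¬ Unique xs
pigeonhole {m} {xs} bounded m<|xs| xs-unique
  with x , x∈xs , upTo-m≢x ← longer⇒∃-avoiding (upTo m) xs-unique
                                (subst (_< length xs) (sym (length-upTo m)) m<|xs|)
  = All.lookup upTo-m≢x (∈-upTo⁺ (All.lookup bounded x∈xs)) refl

pigeonhole₄ : ∀ {a b c d} → a < 3 → b < 3 → c < 3 → d < 3 →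
              a ≡ b ⊎ a ≡ c ⊎ a ≡ d ⊎ b ≡ c ⊎ b ≡ d ⊎ c ≡ d
pigeonhole₄ {a} {b} {c} {d} a<3 b<3 c<3 d<3
  with a ≟ b | a ≟ c | a ≟ d | b ≟ c | b ≟ d | c ≟ d
... | yes e | _     | _     | _     | _     | _     = inj₁ e
... | no _  | yes e | _     | _     | _     | _     = inj₂ (inj₁ e)
... | no _  | no _  | yes e | _     | _     | _     = inj₂ (inj₂ (inj₁ e))
... | no _  | no _  | no _  | yes e | _     | _     = inj₂ (inj₂ (inj₂ (inj₁ e)))
... | no _  | no _  | no _  | no _  | yes e | _     = inj₂ (inj₂ (inj₂ (inj₂ (inj₁ e))))
... | no _  | no _  | no _  | no _  | no _  | yes e = inj₂ (inj₂ (inj₂ (inj₂ (inj₂ e))))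
... | no a≢b | no a≢c | no a≢d | no b≢c | no b≢d | no c≢d =
  ⊥-elim (pigeonhole (a<3 ∷ b<3 ∷ c<3 ∷ d<3 ∷ []) ≤-refl
           ((a≢b ∷ a≢c ∷ a≢d ∷ []) ∷ (b≢c ∷ b≢d ∷ []) ∷ (c≢d ∷ []) ∷ [] ∷ []))

%≡%⇒∣∸ : ∀ {x y} d .{{_ : NonZero d}} → x % d ≡ y % d → d ∣ x ∸ y
%≡%⇒∣∸ {x} {y} d x%d≡y%d = divides (x / d ∸ y / d) (begin
  x ∸ y                                     ≡⟨ cong₂ _∸_ (m≡m%n+[m/n]*n x d) (m≡m%n+[m/n]*n y d) ⟩
  (x % d + x / d * d) ∸ (y % d + y / d * d) ≡⟨ cong (λ r → (r + x / d * d) ∸ (y % d + y / d * d)) x%d≡y%d ⟩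
  (y % d + x / d * d) ∸ (y % d + y / d * d) ≡⟨ [m+n]∸[m+o]≡n∸o (y % d) (x / d * d) (y / d * d) ⟩
  x / d * d ∸ y / d * d                     ≡⟨ *-distribʳ-∸ d (x / d) (y / d) ⟨
  (x / d ∸ y / d) * d                       ∎)
  where open ≡-Reasoning

∣diffMod⇔%≡% : ∀ {m} d .{{_ : NonZero d}} → d ∣ m → (u v : Fin m) →
               d ∣ diffMod u v ⇔ toℕ u % d ≡ toℕ v % d
∣diffMod⇔%≡% {m@(suc _)} d d∣m u v = mk⇔ to from
  where
  open ≡-Reasoning
  X : ℕ
  X = toℕ u + m ∸ toℕ v
  X+v≡u+m : X + toℕ v ≡ toℕ u + m
  X+v≡u+m = m∸n+n≡m (≤-trans (<⇒≤ (toℕ<n v)) (m≤n+m m (toℕ u)))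
  to : d ∣ X % m → toℕ u % d ≡ toℕ v % d
  to d∣X%m = begin
    toℕ u % d       ≡⟨ %-remove-+ʳ (toℕ u) d∣m ⟨
    (toℕ u + m) % d ≡⟨ cong (_% d) X+v≡u+m ⟨
    (X + toℕ v) % d ≡⟨ %-remove-+ˡ (toℕ v) (∣n∣m%n⇒∣m d∣m d∣X%m) ⟩
    toℕ v % d       ∎
  from : toℕ u % d ≡ toℕ v % d → d ∣ X % m
  from u%d≡v%d = %-presˡ-∣ (%≡%⇒∣∸ d (trans (%-remove-+ʳ (toℕ u) d∣m) u%d≡v%d)) d∣m

toℕ-mod-% : ∀ {d m} w .{{_ : NonZero d}} .{{_ : NonZero m}} → d ∣ m → toℕ (w mod m) % d ≡ w % d
toℕ-mod-% {d} {m} w d∣m = trans (cong (_% d) (toℕ-fromℕ< (m%n<n w m))) (m∣n⇒o%n%m≡o%m d m w d∣m)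

∣-^ : ∀ {m k} → 1 ≤ k → m ∣ m ^ k
∣-^ {m} {suc k} _ = m∣m*n (m ^ k)

coprime-* : ∀ {d a b} → Coprime d a → Coprime d b → Coprime d (a * b)
coprime-* d⊥a d⊥b (i∣d , i∣ab) =
  d⊥b (i∣d , coprime-divisor (λ (j∣i , j∣a) → d⊥a (∣-trans j∣i i∣d , j∣a)) i∣ab)

coprime-^ : ∀ {d a} k → Coprime d a → Coprime d (a ^ k)
coprime-^ zero    _   (_ , i∣1) = ∣1⇒≡1 i∣1
coprime-^ (suc k) d⊥a           = coprime-* d⊥a (coprime-^ k d⊥a)

prime≢1 : ∀ {p} → Prime p → p ≢ 1
prime≢1 p-prime = nonTrivial⇒≢1 {{prime⇒nonTrivial p-prime}}

∤⇒coprime : ∀ {p d} → Prime p → ¬ p ∣ d → Coprime d p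
∤⇒coprime p-prime p∤d (i∣d , i∣p) with prime⇒irreducible p-prime i∣p
... | inj₁ i≡1  = i≡1
... | inj₂ refl = ⊥-elim (p∤d i∣d)

distinct-primes⇒coprime : ∀ {p q} → Prime p → Prime q → p ≢ q → Coprime p q
distinct-primes⇒coprime p-prime q-prime p≢q = ∤⇒coprime q-prime λ q∣p →
  [ prime≢1 q-prime , p≢q ∘ sym ] (prime⇒irreducible p-prime q∣p)

InPhi⇒%≢% : ∀ {m r} .{{_ : NonZero r}} → Prime r → r ∣ m → {b b′ : Fin m} → InPhi b b′ →
            toℕ b % r ≢ toℕ b′ % r
InPhi⇒%≢% r-prime r∣m {b} {b′} b⊥b′ e =
  prime≢1 r-prime (b⊥b′ (Equivalence.from (∣diffMod⇔%≡% _ r∣m b b′) e , r∣m))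

%≢%⇒∤diffMod : ∀ {m r} .{{_ : NonZero r}} → r ∣ m → {b b′ : Fin m} → toℕ b % r ≢ toℕ b′ % r →
               ¬ r ∣ diffMod b b′
%≢%⇒∤diffMod r∣m {b} {b′} b≢b′ = b≢b′ ∘ Equivalence.to (∣diffMod⇔%≡% _ r∣m b b′)

-- The witness is w = a + x c P with c = b + (Q - 1) a: since x P = 1 + y Q, w ≡ a + c ≡ b (mod Q).
crt-Bézout : ∀ {P Q} .{{_ : NonZero P}} .{{_ : NonZero Q}} x y → 1 + y * Q ≡ x * P →
             ∀ a b → ∃ λ w → w % P ≡ a % P × w % Q ≡ b % Q
crt-Bézout {P} {Q@(suc Q′)} x y 1+yQ≡xP a b =
  a + x * c * P , [m+kn]%n≡m%n a (x * c) P , (begin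
    (a + x * c * P) % Q       ≡⟨ cong (_% Q) w≡b+[a+yc]Q ⟩
    (b + (a + y * c) * Q) % Q ≡⟨ [m+kn]%n≡m%n b (a + y * c) Q ⟩
    b % Q                     ∎)
  where
  open ≡-Reasoning
  c : ℕ
  c = b + Q′ * a
  regroup : ∀ x c P → x * c * P ≡ c * (x * P)
  regroup = solve-∀
  expand : ∀ a b y Q′ → a + (b + Q′ * a) * (1 + y * suc Q′) ≡ b + (a + y * (b + Q′ * a)) * suc Q′
  expand = solve-∀
  w≡b+[a+yc]Q : a + x * c * P ≡ b + (a + y * c) * Q
  w≡b+[a+yc]Q = begin
    a + x * c * P       ≡⟨ cong (a +_) (regroup x c P) ⟩
    a + c * (x * P)     ≡⟨ cong (λ z → a + c * z) 1+yQ≡xP ⟨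
    a + c * (1 + y * Q) ≡⟨ expand a b y Q′ ⟩
    b + (a + y * c) * Q ∎

crt : ∀ {P Q} .{{_ : NonZero P}} .{{_ : NonZero Q}} → Coprime P Q →
      ∀ a b → ∃ λ w → w % P ≡ a % P × w % Q ≡ b % Q
crt P⊥Q a b with coprime-Bézout P⊥Q
... | Bézout.+- x y eq = crt-Bézout x y eq a b
... | Bézout.-+ x y eq with w , w%Q , w%P ← crt-Bézout y x eq b a = w , w%P , w%Q

module _ {a b : ℕ} where

  _≟ᵛ_ : DecidableEquality (Vertex a b)
  _≟ᵛ_ = ≡-dec _≟ᶠ_ _≟ᶠ_

  blocked⇒¬TotalDominating : ∀ {T : List (Vertex a b)} x → All (¬_ ∘ Adj x) T → ¬ IsTotalDominating T
  blocked⇒¬TotalDominating x blocked td with _ , t∈T , adj ← td x = All.lookup blocked t∈T adj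

  hub⇒InducesConnected : ∀ {T : List (Vertex a b)} {h} → h ∈ T →
                         (∀ {t} → t ∈ T → t ≢ h → Adj t h × Adj h t) → InducesConnected T
  hub⇒InducesConnected {T} {h} h∈T spoke x∈T y∈T = toHub x∈T (fromHub y∈T)
    where
    toHub : ∀ {x y} → x ∈ T → ReachIn T h y → ReachIn T x y
    toHub {x} x∈T h⇝y with x ≟ᵛ h
    ... | yes refl = h⇝y
    ... | no x≢h   = step (proj₁ (spoke x∈T x≢h)) h∈T h⇝y
    fromHub : ∀ {y} → y ∈ T → ReachIn T h y
    fromHub {y} y∈T with y ≟ᵛ h
    ... | yes refl = here
    ... | no y≢h   = step (proj₂ (spoke y∈T y≢h)) y∈T here

  walk⇒neighbour : ∀ {T : List (Vertex a b)} {x y} → x ≢ y → ReachIn T x y → ∃ λ t → t ∈ T × Adj x t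
  walk⇒neighbour x≢x here             = ⊥-elim (x≢x refl)
  walk⇒neighbour _   (step adj t∈T _) = _ , t∈T , adj

  ConnectedDominating⇒TotalDominating : ∀ {T : List (Vertex a b)} → Unique T → 2 ≤ length T →
                                        IsConnectedDominating T → IsTotalDominating T
  ConnectedDominating⇒TotalDominating {s ∷ s′ ∷ _} ((s≢s′ ∷ _) ∷ _) _ (dom , conn) x with dom x
  ... | inj₂ neighbour = neighbour
  ... | inj₁ x∈T with x ≟ᵛ s
  ...   | yes refl = walk⇒neighbour s≢s′ (conn x∈T (there (here refl)))
  ...   | no x≢s   = walk⇒neighbour x≢s (conn x∈T (here refl))
  ConnectedDominating⇒TotalDominating {_ ∷ []} _ (s≤s ())

  IsMinSize-intro : ∀ {P : List (Vertex a b) → Set} {k} T → Unique T → length T ≡ k → P T →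
                    (∀ T → Unique T → length T < k → ¬ P T) → IsMinSize P k
  IsMinSize-intro T T-unique |T|≡k PT smaller =
    (T , T-unique , |T|≡k , PT) , λ T′ T′-unique PT′ → ≮⇒≥ λ |T′|<k → smaller T′ T′-unique |T′|<k PT′

data Coord : Set where
  u v%p v%q : Coord

module Cayley {p q α β : ℕ} (p-prime : Prime p) (q-prime : Prime q) (p≢q : p ≢ q)
              (1≤α : 1 ≤ α) (1≤β : 1 ≤ β) where

  instance
    p≢0 : NonZero p
    p≢0 = prime⇒nonZero p-prime
    q≢0 : NonZero q
    q≢0 = prime⇒nonZero q-prime

  n : ℕ
  n = p ^ α * q ^ β

  instance
    n≢0 : NonZero n
    n≢0 = m*n≢0 (p ^ α) (q ^ β) {{m^n≢0 p α}} {{m^n≢0 q β}}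

  p∣n : p ∣ n
  p∣n = ∣-trans (∣-^ 1≤α) (m∣m*n (q ^ β))

  q∣n : q ∣ n
  q∣n = ∣-trans (∣-^ 1≤β) (n∣m*n (p ^ α))

  V : Set
  V = Vertex p n

  modulus : Coord → ℕ
  modulus u   = p
  modulus v%p = p
  modulus v%q = q

  residue : Coord → ℕ → ℕ
  residue u   a = a % p
  residue v%p a = a % p
  residue v%q a = a % q

  residue-small : ∀ k {a} → a < modulus k → residue k a ≡ a
  residue-small u   = m<n⇒m%n≡m
  residue-small v%p = m<n⇒m%n≡m
  residue-small v%q = m<n⇒m%n≡m

  -- Reducing the ℤ_p-component mod p changes nothing, but makes all three coordinates alike.
  coord : Coord → V → ℕ
  coord u   (a , _) = toℕ a % p
  coord v%p (_ , b) = toℕ b % p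
  coord v%q (_ , b) = toℕ b % q

  coord<modulus : ∀ k x → coord k x < modulus k
  coord<modulus u   (a , _) = m%n<n (toℕ a) p
  coord<modulus v%p (_ , b) = m%n<n (toℕ b) p
  coord<modulus v%q (_ , b) = m%n<n (toℕ b) q

  shares⇒¬Adj : ∀ k {x y} → coord k x ≡ coord k y → ¬ Adj x y
  shares⇒¬Adj u   e (a⊥a′ , _) = InPhi⇒%≢% p-prime ∣-refl a⊥a′ e
  shares⇒¬Adj v%p e (_ , b⊥b′) = InPhi⇒%≢% p-prime p∣n b⊥b′ e
  shares⇒¬Adj v%q e (_ , b⊥b′) = InPhi⇒%≢% q-prime q∣n b⊥b′ e

  distinct⇒Adj : ∀ {x y} → (∀ k → coord k x ≢ coord k y) → Adj x y
  distinct⇒Adj distinct =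
      ∤⇒coprime p-prime (%≢%⇒∤diffMod ∣-refl (distinct u))
    , coprime-* (coprime-^ α (∤⇒coprime p-prime (%≢%⇒∤diffMod p∣n (distinct v%p))))
                (coprime-^ β (∤⇒coprime q-prime (%≢%⇒∤diffMod q∣n (distinct v%q))))

  Adj-sym : ∀ {x y} → Adj x y → Adj y x
  Adj-sym adj = distinct⇒Adj λ k e → shares⇒¬Adj k (sym e) adj

  crt-pq : ∀ a b → ∃ λ w → w % p ≡ a % p × w % q ≡ b % q
  crt-pq = crt (distinct-primes⇒coprime p-prime q-prime p≢q)

  vertex : (Coord → ℕ) → V
  vertex s = s u mod p , proj₁ (crt-pq (s v%p) (s v%q)) mod n

  coord-vertex : ∀ s k → coord k (vertex s) ≡ residue k (s k)
  coord-vertex s u                                          = toℕ-mod-% (s u) ∣-refl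
  coord-vertex s v%p with w , w%p , _ ← crt-pq (s v%p) (s v%q) = trans (toℕ-mod-% w p∣n) w%p
  coord-vertex s v%q with w , _ , w%q ← crt-pq (s v%p) (s v%q) = trans (toℕ-mod-% w q∣n) w%q

  coord-vertex-small : ∀ s k {m} → s k < m → m ≤ modulus k → coord k (vertex s) ≡ s k
  coord-vertex-small s k sk<m m≤modulus = trans (coord-vertex s k) (residue-small k (<-≤-trans sk<m m≤modulus))

  Adj-vertex : ∀ {x} s → (∀ k → coord k x ≢ residue k (s k)) → Adj x (vertex s)
  Adj-vertex {x} s distinct = distinct⇒Adj λ k → subst (coord k x ≢_) (sym (coord-vertex s k)) (distinct k)

  Covered : (Coord → V) → V → Set
  Covered t x = ∃ λ k → coord k x ≡ coord k (t k)

  covered⇒¬TotalDominating : ∀ t {T} → All (Covered t) T → ¬ IsTotalDominating T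
  covered⇒¬TotalDominating t = blocked⇒¬TotalDominating blocker ∘ All.map λ (k , e) →
    shares⇒¬Adj k (trans (coord-vertex-small (λ j → coord j (t j)) k (coord<modulus k (t k)) ≤-refl) (sym e))
    where
    blocker : V
    blocker = vertex (λ j → coord j (t j))

  triple : V → V → V → Coord → V
  triple a b c u   = a
  triple a b c v%p = b
  triple a b c v%q = c

  ¬TotalDominating-<4 : ∀ T → length T < 4 → ¬ IsTotalDominating T
  ¬TotalDominating-<4 []               _ = covered⇒¬TotalDominating (λ _ → vertex (λ _ → 0)) []
  ¬TotalDominating-<4 (a ∷ [])         _ = covered⇒¬TotalDominating (triple a a a) ((u , refl) ∷ [])
  ¬TotalDominating-<4 (a ∷ b ∷ [])     _ =
    covered⇒¬TotalDominating (triple a b b) ((u , refl) ∷ (v%p , refl) ∷ [])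
  ¬TotalDominating-<4 (a ∷ b ∷ c ∷ []) _ =
    covered⇒¬TotalDominating (triple a b c) ((u , refl) ∷ (v%p , refl) ∷ (v%q , refl) ∷ [])
  ¬TotalDominating-<4 (_ ∷ _ ∷ _ ∷ _ ∷ _) (s≤s (s≤s (s≤s (s≤s ()))))

  placing : Coord → V → V → V → Coord → V
  placing u   s c d = triple s c d
  placing v%p s c d = triple c s d
  placing v%q s c d = triple c d s

  covered-pair : ∀ k {s s′} c d → coord k s ≡ coord k s′ →
                 All (Covered (placing k s c d)) (s ∷ s′ ∷ c ∷ d ∷ [])
  covered-pair u   c d e = (u , refl) ∷ (u , sym e) ∷ (v%p , refl) ∷ (v%q , refl) ∷ []
  covered-pair v%p c d e = (v%p , refl) ∷ (v%p , sym e) ∷ (u , refl) ∷ (v%q , refl) ∷ []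
  covered-pair v%q c d e = (v%q , refl) ∷ (v%q , sym e) ∷ (u , refl) ∷ (v%p , refl) ∷ []

  ¬TotalDominating-4 : ∀ k → modulus k ≡ 3 → ∀ T → length T ≡ 4 → ¬ IsTotalDominating T
  ¬TotalDominating-4 k modulus≡3 (a ∷ b ∷ c ∷ d ∷ []) _
    with pigeonhole₄ (coord<3 a) (coord<3 b) (coord<3 c) (coord<3 d)
    where
    coord<3 : ∀ x → coord k x < 3
    coord<3 x = subst (coord k x <_) modulus≡3 (coord<modulus k x)
  ... | inj₁ a≈b = covered⇒¬TotalDominating _ (covered-pair k c d a≈b)
  ... | inj₂ (inj₁ a≈c) with ca ∷ cc ∷ cb ∷ cd ∷ [] ← covered-pair k b d a≈c =
    covered⇒¬TotalDominating _ (ca ∷ cb ∷ cc ∷ cd ∷ [])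
  ... | inj₂ (inj₂ (inj₁ a≈d)) with ca ∷ cd ∷ cb ∷ cc ∷ [] ← covered-pair k b c a≈d =
    covered⇒¬TotalDominating _ (ca ∷ cb ∷ cc ∷ cd ∷ [])
  ... | inj₂ (inj₂ (inj₂ (inj₁ b≈c))) with cb ∷ cc ∷ ca ∷ cd ∷ [] ← covered-pair k a d b≈c =
    covered⇒¬TotalDominating _ (ca ∷ cb ∷ cc ∷ cd ∷ [])
  ... | inj₂ (inj₂ (inj₂ (inj₂ (inj₁ b≈d)))) with cb ∷ cd ∷ ca ∷ cc ∷ [] ← covered-pair k a c b≈d =
    covered⇒¬TotalDominating _ (ca ∷ cb ∷ cc ∷ cd ∷ [])
  ... | inj₂ (inj₂ (inj₂ (inj₂ (inj₂ c≈d)))) with cc ∷ cd ∷ ca ∷ cb ∷ [] ← covered-pair k a b c≈d =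
    covered⇒¬TotalDominating _ (ca ∷ cb ∷ cc ∷ cd ∷ [])

  ¬TotalDominating-<5 : ∀ k → modulus k ≡ 3 → ∀ T → length T < 5 → ¬ IsTotalDominating T
  ¬TotalDominating-<5 k modulus≡3 T |T|<5 with m<1+n⇒m<n∨m≡n |T|<5
  ... | inj₁ |T|<4 = ¬TotalDominating-<4 T |T|<4
  ... | inj₂ |T|≡4 = ¬TotalDominating-4 k modulus≡3 T |T|≡4

  another : (b : Fin n) → ∃ λ b′ → b′ ≢ b
  another b with toℕ b ≟ 0
  ... | yes b≡0 = fromℕ< 1<n , λ e → 1+n≢0 (trans (sym (toℕ-fromℕ< 1<n)) (trans (cong toℕ e) b≡0))
    where
    1<n : 1 < n
    1<n = <-≤-trans (nonTrivial⇒n>1 p {{prime⇒nonTrivial p-prime}}) (∣⇒≤ p∣n)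
  ... | no b≢0  = fromℕ< 0<n , λ e → b≢0 (trans (cong toℕ (sym e)) (toℕ-fromℕ< 0<n))
    where
    0<n : 0 < n
    0<n = >-nonZero⁻¹ n

  ¬Dominating-≤1 : ∀ T → length T ≤ 1 → ¬ IsDominating T
  ¬Dominating-≤1 [] _ dom with dom (vertex (λ _ → 0))
  ... | inj₁ ()
  ... | inj₂ (_ , () , _)
  ¬Dominating-≤1 ((a , b) ∷ []) _ dom with b′ , b′≢b ← another b with dom (a , b′)
  ... | inj₁ (here e)              = b′≢b (cong proj₂ e)
  ... | inj₂ (_ , here refl , adj) = shares⇒¬Adj u refl adj
  ¬Dominating-≤1 (_ ∷ _ ∷ _) (s≤s ())

  γt≡γc≡ : ∀ {k} T → Unique T → length T ≡ k → IsTotalDominating T → InducesConnected T →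
           (∀ T → length T < k → ¬ IsTotalDominating T) → γt≡ p n k × γc≡ p n k
  γt≡γc≡ {k} T T-unique |T|≡k td connected smaller =
      IsMinSize-intro T T-unique |T|≡k td (λ T′ _ → smaller T′)
    , IsMinSize-intro T T-unique |T|≡k ((λ x → inj₂ (td x)) , λ {_} {_} → connected) smaller-cd
    where
    smaller-cd : ∀ T′ → Unique T′ → length T′ < k → ¬ IsConnectedDominating T′
    smaller-cd T′ T′-unique |T′|<k cd with 2 ≤? length T′
    ... | yes 2≤|T′| = smaller T′ |T′|<k (ConnectedDominating⇒TotalDominating T′-unique 2≤|T′| cd)
    ... | no 2≰|T′|  = ¬Dominating-≤1 T′ (s≤s⁻¹ (≰⇒> 2≰|T′|)) (proj₁ cd)

  applyUpTo-Unique : ∀ (f : ℕ → V) k {K} → (∀ {i} → i < K → coord k (f i) ≡ i) → Unique (applyUpTo f K)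
  applyUpTo-Unique f k {K} coord-f≡id = Unique.applyUpTo⁺₁ f K λ i<j j<K fi≡fj →
    <⇒≢ i<j (trans (sym (coord-f≡id (<-trans i<j j<K))) (trans (cong (coord k) fi≡fj) (coord-f≡id j<K)))

  applyUpTo-hub⇒InducesConnected : ∀ (f : ℕ → V) {K h} → h < K →
    (∀ {j} → j < K → j ≢ h → Adj (f j) (f h)) → InducesConnected (applyUpTo f K)
  applyUpTo-hub⇒InducesConnected f {K} {h} h<K spoke = hub⇒InducesConnected (∈-applyUpTo⁺ f h<K) spoke′
    where
    spoke′ : ∀ {t} → t ∈ applyUpTo f K → t ≢ f h → Adj t (f h) × Adj (f h) t
    spoke′ t∈T t≢fh with j , j<K , refl ← ∈-applyUpTo⁻ f t∈T =
      let adj = spoke j<K (λ { refl → t≢fh refl }) in adj , Adj-sym adj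

  diagonal : ℕ → V
  diagonal i = vertex (λ _ → i)

2<4 : 2 < 4
2<4 = s≤s (s≤s (s≤s z≤n))

2<5 : 2 < 5
2<5 = <-trans 2<4 (n<1+n 4)

module Cayley-p≥5-q≥5 {p q α β : ℕ} (p-prime : Prime p) (q-prime : Prime q) (p≢q : p ≢ q)
                      (1≤α : 1 ≤ α) (1≤β : 1 ≤ β) (5≤p : 5 ≤ p) (5≤q : 5 ≤ q) where

  open Cayley p-prime q-prime p≢q 1≤α 1≤β

  5≤modulus : ∀ k → 5 ≤ modulus k
  5≤modulus u   = 5≤p
  5≤modulus v%p = 5≤p
  5≤modulus v%q = 5≤q

  coord-diagonal : ∀ k {i} → i < 5 → coord k (diagonal i) ≡ i
  coord-diagonal k {i} i<5 = coord-vertex-small (λ _ → i) k i<5 (5≤modulus k)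

  avoiding⇒Adj-diagonal : ∀ x {i} → i < 5 → (∀ k → coord k x ≢ i) → Adj x (diagonal i)
  avoiding⇒Adj-diagonal x i<5 avoiding =
    distinct⇒Adj λ k → subst (coord k x ≢_) (sym (coord-diagonal k i<5)) (avoiding k)

  diagonal-TotalDominating : IsTotalDominating (applyUpTo diagonal 4)
  diagonal-TotalDominating x
    with i , i∈ , x₁≢i ∷ x₂≢i ∷ x₃≢i ∷ [] ← longer⇒∃-avoiding (coord u x ∷ coord v%p x ∷ coord v%q x ∷ [])
                                               (Unique.upTo⁺ 4) ≤-refl
    = diagonal i , ∈-applyUpTo⁺ diagonal (∈-upTo⁻ i∈) ,
      avoiding⇒Adj-diagonal x (<-trans (∈-upTo⁻ i∈) (n<1+n 4)) λ { u → x₁≢i ; v%p → x₂≢i ; v%q → x₃≢i }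

  γ≡4 : γt≡ p n 4 × γc≡ p n 4
  γ≡4 = γt≡γc≡ (applyUpTo diagonal 4)
    (applyUpTo-Unique diagonal u λ i<4 → coord-diagonal u (<-trans i<4 (n<1+n 4)))
    (length-applyUpTo diagonal 4)
    diagonal-TotalDominating
    (applyUpTo-hub⇒InducesConnected diagonal 2<4 λ {j} j<4 j≢2 → avoiding⇒Adj-diagonal (diagonal j) 2<5
      λ k e → j≢2 (trans (sym (coord-diagonal k (<-trans j<4 (n<1+n 4)))) e))
    ¬TotalDominating-<4

residue≢? : ∀ c → Decidable (λ i → i % 3 ≢ c)
residue≢? c i = ¬? (i % 3 ≟ c)

length-filter-residue≢ : ∀ {c} → c < 3 → 3 ≤ length (filter (residue≢? c) (upTo 5))
length-filter-residue≢ {0} _ = s≤s (s≤s (s≤s z≤n))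
length-filter-residue≢ {1} _ = s≤s (s≤s (s≤s z≤n))
length-filter-residue≢ {2} _ = s≤s (s≤s (s≤s z≤n))
length-filter-residue≢ {suc (suc (suc _))} (s≤s (s≤s (s≤s ())))

%3≢2 : ∀ {j} → j < 5 → j ≢ 2 → j % 3 ≢ 2
%3≢2 {0} _ _   = λ ()
%3≢2 {1} _ _   = λ ()
%3≢2 {2} _ 2≢2 = ⊥-elim (2≢2 refl)
%3≢2 {3} _ _   = λ ()
%3≢2 {4} _ _   = λ ()
%3≢2 {suc (suc (suc (suc (suc _))))} (s≤s (s≤s (s≤s (s≤s (s≤s ())))))

module Cayley-q≡3 {p α β : ℕ} (p-prime : Prime p) (3-prime : Prime 3) (p≢3 : p ≢ 3)
                  (1≤α : 1 ≤ α) (1≤β : 1 ≤ β) (5≤p : 5 ≤ p) where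

  open Cayley p-prime 3-prime p≢3 1≤α 1≤β

  avoiding⇒Adj-diagonal : ∀ x {i} → i < 5 → coord u x ≢ i → coord v%p x ≢ i → coord v%q x ≢ i % 3 →
                          Adj x (diagonal i)
  avoiding⇒Adj-diagonal x {i} i<5 x₁≢i x₂≢i x₃≢i%3 = Adj-vertex (λ _ → i) λ
    { u   → λ e → x₁≢i (trans e (residue-small u (<-≤-trans i<5 5≤p)))
    ; v%p → λ e → x₂≢i (trans e (residue-small v%p (<-≤-trans i<5 5≤p)))
    ; v%q → x₃≢i%3 }

  diagonal-TotalDominating : IsTotalDominating (applyUpTo diagonal 5)
  diagonal-TotalDominating x
    with i , i∈ , x₁≢i ∷ x₂≢i ∷ [] ← longer⇒∃-avoiding (coord u x ∷ coord v%p x ∷ [])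
                                       (Unique.filter⁺ (residue≢? (coord v%q x)) (Unique.upTo⁺ 5))
                                       (length-filter-residue≢ (coord<modulus v%q x))
    with i∈upTo5 , i%3≢x₃ ← ∈-filter⁻ (residue≢? (coord v%q x)) i∈
    = diagonal i , ∈-applyUpTo⁺ diagonal (∈-upTo⁻ i∈upTo5) ,
      avoiding⇒Adj-diagonal x (∈-upTo⁻ i∈upTo5) x₁≢i x₂≢i (≢-sym i%3≢x₃)

  γ≡5 : γt≡ p n 5 × γc≡ p n 5
  γ≡5 = γt≡γc≡ (applyUpTo diagonal 5)
    (applyUpTo-Unique diagonal u λ {i} i<5 → coord-vertex-small (λ _ → i) u i<5 5≤p)
    (length-applyUpTo diagonal 5)
    diagonal-TotalDominating
    (applyUpTo-hub⇒InducesConnected diagonal 2<5 λ {j} j<5 j≢2 → avoiding⇒Adj-diagonal (diagonal j) 2<5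
      (j≢2 ∘ trans (sym (coord-vertex-small (λ _ → j) u j<5 5≤p)))
      (j≢2 ∘ trans (sym (coord-vertex-small (λ _ → j) v%p j<5 5≤p)))
      (%3≢2 j<5 j≢2 ∘ trans (sym (coord-vertex (λ _ → j) v%q))))
    (¬TotalDominating-<5 v%q refl)

-- For i < 5 the pairs (i mod 3 , tent i) are (0,0), (1,1), (2,2), (0,1), (1,0): deleting any row
-- and any column of ℤ₃ × ℤ₃ leaves at least two of them.
tent : ℕ → ℕ
tent i = i ⊓ (4 ∸ i)

tent-signature : ℕ → Coord → ℕ
tent-signature i v%p = tent i
tent-signature i _   = i

residue≢∧tent≢? : ∀ a b → Decidable (λ i → i % 3 ≢ a × tent i % 3 ≢ b)
residue≢∧tent≢? a b i = ¬? (i % 3 ≟ a) ×-dec ¬? (tent i % 3 ≟ b)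

length-filter-residue≢∧tent≢ : ∀ {a b} → a < 3 → b < 3 → 2 ≤ length (filter (residue≢∧tent≢? a b) (upTo 5))
length-filter-residue≢∧tent≢ {0} {0} _ _ = s≤s (s≤s z≤n)
length-filter-residue≢∧tent≢ {0} {1} _ _ = s≤s (s≤s z≤n)
length-filter-residue≢∧tent≢ {0} {2} _ _ = s≤s (s≤s z≤n)
length-filter-residue≢∧tent≢ {1} {0} _ _ = s≤s (s≤s z≤n)
length-filter-residue≢∧tent≢ {1} {1} _ _ = s≤s (s≤s z≤n)
length-filter-residue≢∧tent≢ {1} {2} _ _ = s≤s (s≤s z≤n)
length-filter-residue≢∧tent≢ {2} {0} _ _ = s≤s (s≤s z≤n)
length-filter-residue≢∧tent≢ {2} {1} _ _ = s≤s (s≤s z≤n)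
length-filter-residue≢∧tent≢ {2} {2} _ _ = s≤s (s≤s z≤n)
length-filter-residue≢∧tent≢ {suc (suc (suc _))} (s≤s (s≤s (s≤s ()))) _
length-filter-residue≢∧tent≢ {_} {suc (suc (suc _))} _ (s≤s (s≤s (s≤s ())))

tent%3≢2 : ∀ {j} → j < 5 → j ≢ 2 → tent j % 3 ≢ 2
tent%3≢2 {0} _ _   = λ ()
tent%3≢2 {1} _ _   = λ ()
tent%3≢2 {2} _ 2≢2 = ⊥-elim (2≢2 refl)
tent%3≢2 {3} _ _   = λ ()
tent%3≢2 {4} _ _   = λ ()
tent%3≢2 {suc (suc (suc (suc (suc _))))} (s≤s (s≤s (s≤s (s≤s (s≤s ())))))

module Cayley-p≡3 {q α β : ℕ} (3-prime : Prime 3) (q-prime : Prime q) (3≢q : 3 ≢ q)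
                  (1≤α : 1 ≤ α) (1≤β : 1 ≤ β) (5≤q : 5 ≤ q) where

  open Cayley 3-prime q-prime 3≢q 1≤α 1≤β

  tented : ℕ → V
  tented i = vertex (tent-signature i)

  avoiding⇒Adj-tented : ∀ x {i} → i < 5 → coord u x ≢ i % 3 → coord v%p x ≢ tent i % 3 → coord v%q x ≢ i →
                        Adj x (tented i)
  avoiding⇒Adj-tented x {i} i<5 x₁≢i%3 x₂≢tent x₃≢i = Adj-vertex (tent-signature i) λ
    { u   → x₁≢i%3
    ; v%p → x₂≢tent
    ; v%q → λ e → x₃≢i (trans e (residue-small v%q (<-≤-trans i<5 5≤q))) }

  tented-TotalDominating : IsTotalDominating (applyUpTo tented 5)
  tented-TotalDominating x
    with i , i∈ , x₃≢i ∷ [] ← longer⇒∃-avoiding (coord v%q x ∷ [])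
                                (Unique.filter⁺ (residue≢∧tent≢? (coord u x) (coord v%p x)) (Unique.upTo⁺ 5))
                                (length-filter-residue≢∧tent≢ (coord<modulus u x) (coord<modulus v%p x))
    with i∈upTo5 , i%3≢x₁ , tent≢x₂ ← ∈-filter⁻ (residue≢∧tent≢? (coord u x) (coord v%p x)) i∈
    = tented i , ∈-applyUpTo⁺ tented (∈-upTo⁻ i∈upTo5) ,
      avoiding⇒Adj-tented x (∈-upTo⁻ i∈upTo5) (≢-sym i%3≢x₁) (≢-sym tent≢x₂) x₃≢i

  γ≡5 : γt≡ 3 n 5 × γc≡ 3 n 5
  γ≡5 = γt≡γc≡ (applyUpTo tented 5)
    (applyUpTo-Unique tented v%q λ {i} i<5 → coord-vertex-small (tent-signature i) v%q i<5 5≤q)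
    (length-applyUpTo tented 5)
    tented-TotalDominating
    (applyUpTo-hub⇒InducesConnected tented 2<5 λ {j} j<5 j≢2 → avoiding⇒Adj-tented (tented j) 2<5
      (%3≢2 j<5 j≢2 ∘ trans (sym (coord-vertex (tent-signature j) u)))
      (tent%3≢2 j<5 j≢2 ∘ trans (sym (coord-vertex (tent-signature j) v%p)))
      (j≢2 ∘ trans (sym (coord-vertex-small (tent-signature j) v%q j<5 5≤q))))
    (¬TotalDominating-<5 u refl)

prime-≢3⇒5≤ : ∀ {r} → Prime r → 3 ≤ r → r ≢ 3 → 5 ≤ r
prime-≢3⇒5≤ {0} _ ()
prime-≢3⇒5≤ {1} _ (s≤s ())
prime-≢3⇒5≤ {2} _ (s≤s (s≤s ()))
prime-≢3⇒5≤ {3} _       _ 3≢3 = ⊥-elim (3≢3 refl)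
prime-≢3⇒5≤ {4} 4-prime _ _   = ⊥-elim (composite⇒¬prime composite[4] 4-prime)
prime-≢3⇒5≤ {suc (suc (suc (suc (suc _))))} _ _ _ = s≤s (s≤s (s≤s (s≤s (s≤s z≤n))))

proposition3p6 : (p q α β : ℕ) → Prime p → Prime q → p ≢ q → 3 ≤ p → 3 ≤ q → 1 ≤ α → 1 ≤ β →
    ((p ≡ 3 ⊎ q ≡ 3) → γt≡ p (p ^ α * q ^ β) 5 × γc≡ p (p ^ α * q ^ β) 5)
    × ((5 ≤ p × 5 ≤ q) → γt≡ p (p ^ α * q ^ β) 4 × γc≡ p (p ^ α * q ^ β) 4)
proposition3p6 p q α β p-prime q-prime p≢q 3≤p 3≤q 1≤α 1≤β =
    [ (λ { refl → Cayley-p≡3.γ≡5 p-prime q-prime p≢q 1≤α 1≤β (prime-≢3⇒5≤ q-prime 3≤q (p≢q ∘ sym)) })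
    , (λ { refl → Cayley-q≡3.γ≡5 p-prime q-prime p≢q 1≤α 1≤β (prime-≢3⇒5≤ p-prime 3≤p p≢q) })
    ]
  , λ (5≤p , 5≤q) → Cayley-p≥5-q≥5.γ≡4 p-prime q-prime p≢q 1≤α 1≤β 5≤p 5≤q
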